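{- Let $\Sigma$ be a signed graph and let $v$ be a positive dominating vertex of $\Sigma$. Then \[ \mathsf E(\Sigma,x,y)=y\,\mathsf E(\Sigma\setminus v,x-1,y-1)+(x-y)\,\mathsf E(\Sigma\setminus v,x-1,y+1), \] \[ \mathsf O(\Sigma,x,y)=y\,\mathsf O(\Sigma\setminus v,x-1,y-1)+(x-y-1)\,\mathsf O(\Sigma\setminus v,x-1,y+1)+\mathsf E(\Sigma\setminus v,x-1,y). \]
   Context: A signed graph $\Sigma=(\Gamma,\sigma)$ is a finite simple graph $\Gamma$ with a signature $\sigma:E(\Gamma)\to\{\pm1\}$. A vertex $v$ is a positive dominating vertex if it is joined by a positive edge to every other vertex; the single vertex of the one-vertex graph $K_1$ counts as a positive dominating vertex. $\Sigma\setminus v$ is obtained by deleting $v$ and its incident edges (the vertexless graph $K_0$ has $\mathsf E(K_0,x,y)=\mathsf O(K_0,x,y)=1$). For a finite $C\subseteq\mathbb Z$, a proper $C$-colouring of $\Sigma$ is a map $\kappa:V(\Gamma)\to C$ with $\kappa(v)\ne\sigma(\{v,w\})\kappa(w)$ for every edge $\{v,w\}$. For integers $\lambda\ge\mu\ge0$, a finite $C\subseteq\mathbb Z$ is a $(\lambda,\mu)$-colour set if there are disjoint sets $P,U$ of nonzero integers with $-P=P$, $|U|=\mu$, $(-U)\cap U=\varnothing$, and either $\lambda-\mu$ even, $|P|=\lambda-\mu$, $C=P\cup U$, or $\lambda-\mu$ odd, $|P|=\lambda-\mu-1$, $C=P\cup U\cup\{0\}$. $f(\Sigma,\lambda,\mu)$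 is the number of proper $C$-colourings for any $(\lambda,\mu)$-colour set $C$ (independent of $C$). $\mathsf E(\Sigma,x,y),\mathsf O(\Sigma,x,y)\in\mathbb Z[x,y]$ are the unique polynomials with $f(\Sigma,\lambda,\mu)=\mathsf E(\Sigma,\lambda,\mu)$ for all integers $\lambda\ge\mu\ge0$ with $\lambda-\mu$ even and $f(\Sigma,\lambda,\mu)=\mathsf O(\Sigma,\lambda,\mu)$ whenever $\lambda-\mu$ is odd. The identities are equalities in $\mathbb Z[x,y]$. -}

module Defs where

open import Data.Nat as ℕ using (ℕ; zero; suc)
open import Data.Integer as ℤ using (ℤ; +_; -_; 0ℤ; 1ℤ; -1ℤ)
open import Data.Fin using (Fin; punchIn)
open import Data.Sign using (Sign)
open import Data.Maybe using (Maybe; just; nothing)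
open import Data.Bool using (Bool; true; false; not; _∧_)
open import Data.List using (List; []; _∷_; [_]; map; concatMap; filter; length; allFin)
open import Data.Bool.ListAction using (all)
open import Data.List.Membership.Propositional using (_∈_; _∉_)
open import Data.List.Relation.Unary.Unique.Propositional using (Unique)
open import Data.Vec using (Vec; lookup) renaming ([] to []ᵥ; _∷_ to _∷ᵥ_)
open import Data.Product using (Σ; ∃; ∃-syntax; _×_)
open import Data.Sum using (_⊎_)
open import Relation.Nullary using (¬_)
open import Relation.Nullary.Decidable using (⌊_⌋)
open import Relation.Binary.PropositionalEquality using (_≡_; _≢_)
open import Function.Bundles using (_⇔_)

record SignedGraph (n : ℕ) : Set where
  field
    edge      : Fin n → Fin n → Maybe Sign
    symmetric : ∀ i j → edge i j ≡ edge j i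
    loopless  : ∀ i → edge i i ≡ nothing
open SignedGraph public

signℤ : Sign → ℤ
signℤ Sign.+ = 1ℤ
signℤ Sign.- = -1ℤ

PositiveDominating : ∀ {n} → SignedGraph n → Fin n → Set
PositiveDominating S v = ∀ w → w ≢ v → edge S v w ≡ just Sign.+

delete : ∀ {n} → SignedGraph (suc n) → Fin (suc n) → SignedGraph n
delete S v = record
  { edge      = λ i j → edge S (punchIn v i) (punchIn v j)
  ; symmetric = λ i j → symmetric S (punchIn v i) (punchIn v j)
  ; loopless  = λ i → loopless S (punchIn v i)
  }

-- κ is proper: κ(i) ≠ σ(ij) κ(j) for every edge ij (checked over all
-- ordered pairs, which is equivalent since the edge relation is symmetric).
properB : ∀ {n} → SignedGraph n → Vec ℤ n → Bool
properB {n} S κ = all (λ i → all (λ j → ok (edge S i j) i j) (allFin n)) (allFin n)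
  where
  ok : Maybe Sign → Fin n → Fin n → Bool
  ok nothing  i j = true
  ok (just s) i j = not ⌊ lookup κ i ℤ.≟ (signℤ s ℤ.* lookup κ j) ⌋

-- All maps Fin n → C, for C given as a duplicate-free list.
allVecs : List ℤ → (n : ℕ) → List (Vec ℤ n)
allVecs C zero    = [ []ᵥ ]
allVecs C (suc n) = concatMap (λ c → map (c ∷ᵥ_) (allVecs C n)) C

countProper : ∀ {n} → SignedGraph n → List ℤ → ℕ
countProper {n} S C = length (filter (λ κ → properB S κ Data.Bool.≟ true) (allVecs C n))

-- (λ, μ)-colour sets.  Finite subsets of ℤ are duplicate-free lists;
-- set equalities are expressed by membership.

record ColourSetData (lam mu : ℕ) (C : List ℤ) : Set where
  field
    P U       : List ℤ
    uniqueP   : Unique P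
    uniqueU   : Unique U
    nonzeroP  : ∀ {z} → z ∈ P → z ≢ 0ℤ
    nonzeroU  : ∀ {z} → z ∈ U → z ≢ 0ℤ
    disjoint  : ∀ {z} → z ∈ P → z ∉ U
    symP      : ∀ {z} → z ∈ P → - z ∈ P     -- with P finite: -P = P
    asymU     : ∀ {z} → z ∈ U → - z ∉ U
    sizeU     : length U ≡ mu
    cases     :
      (∃[ k ] (lam ≡ mu ℕ.+ 2 ℕ.* k × length P ≡ 2 ℕ.* k
               × (∀ z → z ∈ C ⇔ (z ∈ P ⊎ z ∈ U))))
      ⊎
      (∃[ k ] (lam ≡ mu ℕ.+ suc (2 ℕ.* k) × length P ≡ 2 ℕ.* k
               × (∀ z → z ∈ C ⇔ (z ∈ P ⊎ z ∈ U ⊎ z ≡ 0ℤ))))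

IsColourSet : ℕ → ℕ → List ℤ → Set
IsColourSet lam mu C = Unique C × ColourSetData lam mu C

-- Polynomials in ℤ[x,y]: coefficient lists, p = Σᵢ Σⱼ cᵢⱼ xⁱ yʲ
-- where the i-th entry of the outer list is the list (cᵢ₀, cᵢ₁, …).

Poly : Set
Poly = List (List ℤ)

evalY : List ℤ → ℤ → ℤ
evalY []       y = 0ℤ
evalY (c ∷ cs) y = c ℤ.+ y ℤ.* evalY cs y

eval : Poly → ℤ → ℤ → ℤ
eval []       x y = 0ℤ
eval (r ∷ rs) x y = evalY r y ℤ.+ x ℤ.* eval rs x y

-- p is (a representative of) 𝖤(S,x,y): agrees with f(S,λ,μ) for all
-- λ ≥ μ ≥ 0 with λ - μ even (for every (λ,μ)-colour set).
IsE : ∀ {n} → SignedGraph n → Poly → Set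
IsE S p = ∀ lam mu k → lam ≡ mu ℕ.+ 2 ℕ.* k → ∀ C → IsColourSet lam mu C →
          + countProper S C ≡ eval p (+ lam) (+ mu)

IsO : ∀ {n} → SignedGraph n → Poly → Set
IsO S p = ∀ lam mu k → lam ≡ mu ℕ.+ suc (2 ℕ.* k) → ∀ C → IsColourSet lam mu C →
          + countProper S C ≡ eval p (+ lam) (+ mu)

-- Colour the positive dominating vertex v first. With v coloured c, a colouring is proper exactly
-- when its restriction to Σ ∖ v is proper and avoids c, so f(Σ, C) = ∑_{c ∈ C} f(Σ ∖ v, C ∖ {c}).
-- Removing one of the μ unpaired colours from a (λ, μ)-colour set leaves a (λ - 1, μ - 1)-colour set,
-- removing one of the λ - μ (or λ - μ - 1) paired colours c leaves a (λ - 1, μ + 1)-colour set, since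
-- -c loses its partner, and removing 0 leaves a (λ - 1, μ)-colour set. This gives both identities at
-- every (λ, μ) ∈ ℕ² of the right parity. Integer polynomials p have x - y ∣ p(x) - p(y) in each
-- variable, and two functions with this property that agree at arbitrarily large integers agree
-- everywhere: their difference at x is a multiple of x - m for some m with |x - m| exceeding it.

module Submission where

open import Defs
open import Data.Nat using (ℕ; suc)
open import Data.Integer using (ℤ; _+_; _-_; _*_; 1ℤ)
open import Data.Fin using (Fin)
open import Data.Product using (_×_)
open import Relation.Binary.PropositionalEquality using (_≡_)

open import Data.Bool as Bool using (Bool; true; false; T)
open import Data.Bool.ListAction using (all)
open import Data.Bool.Properties using (T-≡)
open import Data.Empty using (⊥-elim)
open import Data.Fin as Fin using (punchIn)
open import Data.Fin.Properties using (punchIn-punchOut; punchInᵢ≢i)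
open import Data.Integer as ℤ using (+_; -_; 0ℤ; -1ℤ; ∣_∣; _≟_)
import Data.Integer.Properties as ℤ
open import Data.Integer.Properties
  using (abs-*; ∣i∣≡0⇒i≡0; ∣i-j∣≤∣i∣+∣j∣; i-j≡0⇒i≡j; i≡j⇒i-j≡0; +-identityˡ; *-identityˡ; neg-involutive; neg-injective)
open import Data.Integer.Tactic.RingSolver using (solve-∀)
open import Data.List using (List; []; _∷_; _++_; map; concatMap; filter; length; allFin; applyUpTo)
open import Data.List.Properties
  using (map-cong; map-++; length-++; length-applyUpTo; filter-++; filter-≐; filter-all; filter-none; filter-accept; filter-reject)
open import Data.List.Membership.Propositional using (_∈_; _∉_)
open import Data.List.Membership.Propositional.Properties
  using (∈-filter⁺; ∈-filter⁻; ∈-++⁺ˡ; ∈-++⁺ʳ; ∈-++⁻; ∈-applyUpTo⁻)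
open import Data.List.Relation.Binary.Permutation.Propositional
  using (_↭_; ↭-refl; ↭-sym; ↭-trans; ↭-reflexive; prep; swap; ↭⇒↭ₛ; ↭ₛ⇒↭)
open import Data.List.Relation.Binary.Permutation.Propositional.Properties
  using (∈-resp-↭; ↭-length; shift; ++⁺ˡ; ++⁺ʳ; map⁺)
import Data.List.Relation.Binary.Permutation.Setoid.Properties as PermutationSetoid
open import Data.List.Relation.Unary.All as All using (All; []; _∷_)
import Data.List.Relation.Unary.All.Properties as All
open import Data.List.Relation.Unary.All.Properties using (¬Any⇒All¬; All¬⇒¬Any; all⁺; all⁻; tabulate⁻; ¬All⇒Any¬)
import Data.List.Relation.Unary.Any.Properties as Any
open import Data.List.Relation.Unary.Any using (here; there)
open import Data.List.Relation.Unary.AllPairs using ([]; _∷_)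
import Data.List.Relation.Unary.AllPairs.Properties as AllPairs
open import Data.List.Relation.Unary.Unique.Propositional using (Unique)
import Data.List.Relation.Unary.Unique.Propositional.Properties as Unique
open import Data.Maybe using (Maybe; just; nothing)
open import Data.Nat as ℕ using (zero)
import Data.Nat.Properties as ℕ
open import Algebra.Properties.CommutativeSemigroup ℕ.+-commutativeSemigroup using (interchange)
open import Data.Nat.Divisibility using (divides; >⇒∤)
open import Data.Nat.ListAction using (sum)
open import Data.Nat.ListAction.Properties using (sum-++; sum-↭)
import Data.Nat.Tactic.RingSolver as ℕ-Solver
open import Data.Product using (_,_; proj₁; proj₂; map₂; ∃-syntax)
open import Data.Sign using (Sign)
open import Data.Sum using (_⊎_; inj₁; inj₂; [_,_])
import Data.Sum as Sum
open import Data.Unit using (⊤; tt)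
open import Data.Vec using (Vec; lookup; insertAt) renaming (_∷_ to _∷ᵥ_)
open import Data.Vec.Properties using (insertAt-lookup; insertAt-punchIn)
import Data.Vec.Relation.Unary.All as VecAll
open import Data.Vec.Relation.Unary.All.Properties using (lookup⁺; lookup⁻)
open import Function using (_∘_; _⇔_; mk⇔; Equivalence; case_of_)
open import Level using (0ℓ)
open import Relation.Binary.PropositionalEquality
  using (_≢_; refl; sym; trans; cong; cong₂; subst; setoid; resp; module ≡-Reasoning)
open import Relation.Nullary using (¬_; yes; no; does; ¬?; contradiction)
open import Relation.Nullary.Decidable using (T?; toWitnessFalse; fromWitnessFalse)
open import Relation.Unary using (Pred; Decidable)
open import Relation.Unary.Properties using (_∩?_)

-- Functions with integral difference quotients

DifferenceDivisible : (ℤ → ℤ) → Set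
DifferenceDivisible f = ∀ x y → ∃[ q ] f x ≡ f y + q * (x - y)

private
  constant-shape : ∀ c d → c ≡ c + 0ℤ * d
  constant-shape = solve-∀
  identity-shape : ∀ x y → x ≡ y + 1ℤ * (x - y)
  identity-shape = solve-∀
  sum-shape : ∀ a b p q d → (a + p * d) + (b + q * d) ≡ (a + b) + (p + q) * d
  sum-shape = solve-∀
  product-shape : ∀ a b p q d →
    (a + p * d) * (b + q * d) ≡ a * b + (p * b + a * q + p * q * d) * d
  product-shape = solve-∀
  negation-shape : ∀ a p d → - (a + p * d) ≡ - a + (- p) * d
  negation-shape = solve-∀
  shift-shape : ∀ x y c → (x + c) - (y + c) ≡ x - y
  shift-shape = solve-∀

dd-const : ∀ c → DifferenceDivisible (λ _ → c)
dd-const c x y = 0ℤ , constant-shape c (x - y)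

dd-id : DifferenceDivisible (λ x → x)
dd-id x y = 1ℤ , identity-shape x y

dd-+ : ∀ {f g} → DifferenceDivisible f → DifferenceDivisible g →
       DifferenceDivisible (λ x → f x + g x)
dd-+ {f} {g} df dg x y with df x y | dg x y
... | p , fx | q , gx = p + q , trans (cong₂ _+_ fx gx) (sum-shape (f y) (g y) p q (x - y))

dd-* : ∀ {f g} → DifferenceDivisible f → DifferenceDivisible g →
       DifferenceDivisible (λ x → f x * g x)
dd-* {f} {g} df dg x y with df x y | dg x y
... | p , fx | q , gx =
  p * g y + f y * q + p * q * (x - y) , trans (cong₂ _*_ fx gx) (product-shape (f y) (g y) p q (x - y))

dd-neg : ∀ {f} → DifferenceDivisible f → DifferenceDivisible (λ x → - f x)
dd-neg {f} df x y with df x y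
... | p , fx = - p , trans (cong -_ fx) (negation-shape (f y) p (x - y))

dd-- : ∀ {f g} → DifferenceDivisible f → DifferenceDivisible g →
       DifferenceDivisible (λ x → f x - g x)
dd-- df dg = dd-+ df (dd-neg dg)

dd-shift : ∀ {f} c → DifferenceDivisible f → DifferenceDivisible (λ x → f (x + c))
dd-shift {f} c df x y with df (x + c) (y + c)
... | p , fx = p , trans fx (cong (λ d → f (y + c) + p * d) (shift-shape x y c))

small-multiple≡0 : ∀ {a} q b → a ≡ q * b → ∣ a ∣ ℕ.< ∣ b ∣ → a ≡ 0ℤ
small-multiple≡0 {a} q b a≡qb |a|<|b| with ∣ a ∣ in |a|≡
... | zero  = ∣i∣≡0⇒i≡0 |a|≡
... | suc _ = contradiction (divides ∣ q ∣ (trans (sym |a|≡) (trans (cong ∣_∣ a≡qb) (abs-* q b)))) (>⇒∤ |a|<|b|)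

Unbounded : (ℕ → Set) → Set
Unbounded P = ∀ N → ∃[ m ] N ℕ.≤ m × P m

private
  reverse-shape : ∀ x m → m ≡ x - (x - m)
  reverse-shape = solve-∀

m≤∣x∣+∣x-m∣ : ∀ x m → m ℕ.≤ ∣ x ∣ ℕ.+ ∣ x - + m ∣
m≤∣x∣+∣x-m∣ x m =
  subst (ℕ._≤ ∣ x ∣ ℕ.+ ∣ x - + m ∣) (cong ∣_∣ (sym (reverse-shape x (+ m)))) (∣i-j∣≤∣i∣+∣j∣ x (x - + m))

dd-agree : ∀ {f g} → DifferenceDivisible f → DifferenceDivisible g →
           Unbounded (λ m → f (+ m) ≡ g (+ m)) → ∀ x → f x ≡ g x
dd-agree {f} {g} df dg agree x
  with m , N≤m , fm≡gm ← agree (∣ x ∣ ℕ.+ suc ∣ f x - g x ∣)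
  with q , hx ← dd-- df dg x (+ m)
  = i-j≡0⇒i≡j (f x) (g x) (small-multiple≡0 q (x - + m) h≡ far)
  where
  h≡ : f x - g x ≡ q * (x - + m)
  h≡ = trans hx (trans (cong (_+ q * (x - + m)) (i≡j⇒i-j≡0 fm≡gm)) (+-identityˡ _))
  far : ∣ f x - g x ∣ ℕ.< ∣ x - + m ∣
  far = ℕ.+-cancelˡ-≤ ∣ x ∣ _ _ (ℕ.≤-trans N≤m (m≤∣x∣+∣x-m∣ x m))

DifferenceDivisible₂ : (ℤ → ℤ → ℤ) → Set
DifferenceDivisible₂ F =
  (∀ y → DifferenceDivisible (λ x → F x y)) × (∀ x → DifferenceDivisible (F x))

dd₂-const : ∀ c → DifferenceDivisible₂ (λ _ _ → c)
dd₂-const c = (λ _ → dd-const c) , (λ _ → dd-const c)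

dd₂-x : DifferenceDivisible₂ (λ x _ → x)
dd₂-x = (λ _ → dd-id) , (λ x → dd-const x)

dd₂-y : DifferenceDivisible₂ (λ _ y → y)
dd₂-y = (λ y → dd-const y) , (λ _ → dd-id)

dd₂-+ : ∀ {F G} → DifferenceDivisible₂ F → DifferenceDivisible₂ G →
        DifferenceDivisible₂ (λ x y → F x y + G x y)
dd₂-+ (dFx , dFy) (dGx , dGy) = (λ y → dd-+ (dFx y) (dGx y)) , (λ x → dd-+ (dFy x) (dGy x))

dd₂-* : ∀ {F G} → DifferenceDivisible₂ F → DifferenceDivisible₂ G →
        DifferenceDivisible₂ (λ x y → F x y * G x y)
dd₂-* (dFx , dFy) (dGx , dGy) = (λ y → dd-* (dFx y) (dGx y)) , (λ x → dd-* (dFy x) (dGy x))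

dd₂-- : ∀ {F G} → DifferenceDivisible₂ F → DifferenceDivisible₂ G →
        DifferenceDivisible₂ (λ x y → F x y - G x y)
dd₂-- (dFx , dFy) (dGx , dGy) = (λ y → dd-- (dFx y) (dGx y)) , (λ x → dd-- (dFy x) (dGy x))

dd₂-shiftˣ : ∀ {F} a → DifferenceDivisible₂ F → DifferenceDivisible₂ (λ x y → F (x + a) y)
dd₂-shiftˣ a (dFx , dFy) = (λ y → dd-shift a (dFx y)) , (λ x → dFy (x + a))

dd₂-shiftʸ : ∀ {F} b → DifferenceDivisible₂ F → DifferenceDivisible₂ (λ x y → F x (y + b))
dd₂-shiftʸ b (dFx , dFy) = (λ y → dFx (y + b)) , (λ x → dd-shift b (dFy x))

dd₂-evalY : ∀ r → DifferenceDivisible₂ (λ _ y → evalY r y)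
dd₂-evalY []       = dd₂-const 0ℤ
dd₂-evalY (c ∷ cs) = dd₂-+ (dd₂-const c) (dd₂-* dd₂-y (dd₂-evalY cs))

dd₂-eval : ∀ p → DifferenceDivisible₂ (eval p)
dd₂-eval []       = dd₂-const 0ℤ
dd₂-eval (r ∷ rs) = dd₂-+ (dd₂-evalY r) (dd₂-* dd₂-x (dd₂-eval rs))

dd₂-agree : ∀ {F G} → DifferenceDivisible₂ F → DifferenceDivisible₂ G →
            (∀ mu → Unbounded (λ m → F (+ m) (+ mu) ≡ G (+ m) (+ mu))) →
            ∀ x y → F x y ≡ G x y
dd₂-agree (dFx , dFy) (dGx , dGy) agree x =
  dd-agree (dFy x) (dGy x) (λ mu → mu , ℕ.≤-refl , dd-agree (dFx (+ mu)) (dGx (+ mu)) (agree mu) x)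

-- Counting colourings

count : ∀ {A : Set} {P : Pred A 0ℓ} → Decidable P → List A → ℕ
count P? xs = length (filter P? xs)

module _ {A : Set} {P : Pred A 0ℓ} (P? : Decidable P) where

  count-++ : ∀ xs ys → count P? (xs ++ ys) ≡ count P? xs ℕ.+ count P? ys
  count-++ xs ys = trans (cong length (filter-++ P? xs ys)) (length-++ (filter P? xs))

  count-concatMap : ∀ {B : Set} (f : B → List A) xs →
                    count P? (concatMap f xs) ≡ sum (map (count P? ∘ f) xs)
  count-concatMap f []       = refl
  count-concatMap f (x ∷ xs) = trans (count-++ (f x) _) (cong (count P? (f x) ℕ.+_) (count-concatMap f xs))

  count-map : ∀ {B : Set} (f : B → A) xs → count P? (map f xs) ≡ count (P? ∘ f) xs
  count-map f []       = refl
  count-map f (x ∷ xs) with does (P? (f x))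
  ... | true  = cong suc (count-map f xs)
  ... | false = count-map f xs

sum-map-+ : ∀ {A : Set} (f g : A → ℕ) xs →
            sum (map (λ x → f x ℕ.+ g x) xs) ≡ sum (map f xs) ℕ.+ sum (map g xs)
sum-map-+ f g []       = refl
sum-map-+ f g (x ∷ xs) =
  trans (cong (f x ℕ.+ g x ℕ.+_) (sum-map-+ f g xs)) (interchange (f x) (g x) (sum (map f xs)) (sum (map g xs)))

sum-map-comm : ∀ {A B : Set} (f : A → B → ℕ) xs ys →
  sum (map (λ x → sum (map (f x) ys)) xs) ≡ sum (map (λ y → sum (map (λ x → f x y) xs)) ys)
sum-map-comm f []       ys = sym (sum-map-zero ys)
  where
  sum-map-zero : ∀ ys → sum (map (λ _ → 0) ys) ≡ 0
  sum-map-zero []       = refl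
  sum-map-zero (_ ∷ ys) = sum-map-zero ys
sum-map-comm f (x ∷ xs) ys =
  trans (cong (sum (map (f x) ys) ℕ.+_) (sum-map-comm f xs ys)) (sym (sum-map-+ (f x) _ ys))

sum-map-const : ∀ {A : Set} (f : A → ℕ) {w} xs → (∀ {x} → x ∈ xs → + f x ≡ w) →
                + sum (map f xs) ≡ + length xs * w
sum-map-const f {w} []       _      = sym (ℤ.*-zeroˡ w)
sum-map-const f {w} (x ∷ xs) f≡w = begin
  + (f x ℕ.+ sum (map f xs))     ≡⟨ ℤ.pos-+ (f x) _ ⟩
  + f x + + sum (map f xs)     ≡⟨ cong₂ _+_ (f≡w (here refl)) (sum-map-const f xs (f≡w ∘ there)) ⟩
  w + + length xs * w        ≡⟨ sym (ℤ.suc-* (+ length xs) w) ⟩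
  + length (x ∷ xs) * w ∎
  where open ≡-Reasoning

count-allVecs-suc : ∀ {n} {P : Pred (Vec ℤ (suc n)) 0ℓ} (P? : Decidable P) C →
  count P? (allVecs C (suc n)) ≡ sum (map (λ c → count (P? ∘ (c ∷ᵥ_)) (allVecs C n)) C)
count-allVecs-suc {n} P? C =
  trans (count-concatMap P? _ C) (cong sum (map-cong (λ c → count-map P? (c ∷ᵥ_) (allVecs C n)) C))

count-allVecs-insertAt : ∀ {n} (v : Fin (suc n)) {P : Pred (Vec ℤ (suc n)) 0ℓ} (P? : Decidable P) C →
  count P? (allVecs C (suc n)) ≡ sum (map (λ c → count (P? ∘ λ κ → insertAt κ v c) (allVecs C n)) C)
count-allVecs-insertAt Fin.zero P? C = count-allVecs-suc P? C
count-allVecs-insertAt {suc n} (Fin.suc v) P? C = begin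
  count P? (allVecs C (suc (suc n)))
    ≡⟨ count-allVecs-suc P? C ⟩
  sum (map (λ d → count (P? ∘ (d ∷ᵥ_)) (allVecs C (suc n))) C)
    ≡⟨ cong sum (map-cong (λ d → count-allVecs-insertAt v (P? ∘ (d ∷ᵥ_)) C) C) ⟩
  sum (map (λ d → sum (map (λ c → count (P? ∘ λ κ → d ∷ᵥ insertAt κ v c) (allVecs C n)) C)) C)
    ≡⟨ sum-map-comm (λ d c → count (P? ∘ λ κ → d ∷ᵥ insertAt κ v c) (allVecs C n)) C C ⟩
  sum (map (λ c → sum (map (λ d → count (P? ∘ λ κ → d ∷ᵥ insertAt κ v c) (allVecs C n)) C)) C)
    ≡⟨ cong sum (map-cong (λ c → sym (count-allVecs-suc (P? ∘ λ κ → insertAt κ (Fin.suc v) c) C)) C) ⟩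
  sum (map (λ c → count (P? ∘ λ κ → insertAt κ (Fin.suc v) c) (allVecs C (suc n))) C) ∎
  where open ≡-Reasoning

≢? : (c : ℤ) → Decidable (c ≢_)
≢? c d = ¬? (c ≟ d)

infixl 20 _without_

_without_ : List ℤ → ℤ → List ℤ
C without c = filter (≢? c) C

Avoids : ∀ {n} → ℤ → Vec ℤ n → Set
Avoids c = VecAll.All (c ≢_)

avoids? : ∀ {n} (c : ℤ) → Decidable (Avoids {n} c)
avoids? c = VecAll.all? (≢? c)

filter-∩ : ∀ {A : Set} {P Q : Pred A 0ℓ} (P? : Decidable P) (Q? : Decidable Q) xs →
           filter (P? ∩? Q?) xs ≡ filter Q? (filter P? xs)
filter-∩ P? Q? [] = refl
filter-∩ P? Q? (x ∷ xs) with P? x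
... | no _ = filter-∩ P? Q? xs
... | yes _ with Q? x
...   | yes _ = cong (x ∷_) (filter-∩ P? Q? xs)
...   | no _  = filter-∩ P? Q? xs

module _ (c : ℤ) where

  filter-avoids-map-∷-self : ∀ {n} (L : List (Vec ℤ n)) → filter (avoids? c) (map (c ∷ᵥ_) L) ≡ []
  filter-avoids-map-∷-self L = filter-none (avoids? c) (All.map⁺ (All.universal (λ _ av → VecAll.head av refl) L))

  filter-avoids-map-∷ : ∀ {n d} → c ≢ d → (L : List (Vec ℤ n)) →
    filter (avoids? c) (map (d ∷ᵥ_) L) ≡ map (d ∷ᵥ_) (filter (avoids? c) L)
  filter-avoids-map-∷ c≢d [] = refl
  filter-avoids-map-∷ {d = d} c≢d (κ ∷ L) with c ≟ d
  ... | yes c≡d = contradiction c≡d c≢d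
  ... | no _ with avoids? c κ
  ...   | yes _ = cong (_ ∷_) (filter-avoids-map-∷ c≢d L)
  ...   | no _  = filter-avoids-map-∷ c≢d L

  filter-avoids-allVecs : ∀ C n → filter (avoids? c) (allVecs C n) ≡ allVecs (C without c) n
  filter-avoids-allVecs C zero    = refl
  filter-avoids-allVecs C (suc n) =
    trans (filter-avoids-concatMap C (allVecs C n))
          (cong (λ L → concatMap (λ d → map (d ∷ᵥ_) L) (C without c)) (filter-avoids-allVecs C n))
    where
    filter-avoids-concatMap : ∀ D (L : List (Vec ℤ n)) →
      filter (avoids? c) (concatMap (λ d → map (d ∷ᵥ_) L) D) ≡
      concatMap (λ d → map (d ∷ᵥ_) (filter (avoids? c) L)) (D without c)
    filter-avoids-concatMap []      L = refl
    filter-avoids-concatMap (d ∷ D) L with c ≟ d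
    ... | yes refl = begin
      filter (avoids? c) (map (c ∷ᵥ_) L ++ rest)
        ≡⟨ filter-++ (avoids? c) (map (c ∷ᵥ_) L) rest ⟩
      filter (avoids? c) (map (c ∷ᵥ_) L) ++ filter (avoids? c) rest
        ≡⟨ cong (_++ filter (avoids? c) rest) (filter-avoids-map-∷-self L) ⟩
      filter (avoids? c) rest
        ≡⟨ filter-avoids-concatMap D L ⟩
      concatMap (λ e → map (e ∷ᵥ_) (filter (avoids? c) L)) (D without c) ∎
      where
      open ≡-Reasoning
      rest : List (Vec ℤ (suc n))
      rest = concatMap (λ e → map (e ∷ᵥ_) L) D
    ... | no c≢d = trans (filter-++ (avoids? c) (map (d ∷ᵥ_) L) _)
                         (cong₂ _++_ (filter-avoids-map-∷ c≢d L) (filter-avoids-concatMap D L))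

-- Proper colourings and the dominating vertex

Compatible : Maybe Sign → ℤ → ℤ → Set
Compatible nothing  a b = ⊤
Compatible (just s) a b = a ≢ signℤ s * b

Proper : ∀ {n} → SignedGraph n → Vec ℤ n → Set
Proper S κ = ∀ i j → Compatible (edge S i j) (lookup κ i) (lookup κ j)

all-allFin-violated : ∀ {n} (p : Fin n → Bool) → ¬ T (all p (allFin n)) → ∃[ i ] ¬ T (p i)
all-allFin-violated {n} p ¬all = Any.tabulate⁻ (¬All⇒Any¬ (T? ∘ p) (allFin n) (¬all ∘ all⁻ p))

properB⇒Proper : ∀ {n} (S : SignedGraph n) κ → T (properB S κ) → Proper S κ
properB⇒Proper {n} S κ pr i j
  with edge S i j | tabulate⁻ (all⁺ _ (allFin n) (tabulate⁻ (all⁺ _ (allFin n) pr) i)) j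
... | nothing | _  = tt
... | just s  | ok = toWitnessFalse ok

-- The per-edge test inside properB is local to its definition, so it can only be reached through
-- an edge on which the test fails.
Proper⇒properB : ∀ {n} (S : SignedGraph n) κ → Proper S κ → T (properB S κ)
Proper⇒properB S κ pr with T? (properB S κ)
... | yes ok = ok
... | no ¬ok with i , ¬okᵢ ← all-allFin-violated _ ¬ok with j , ¬okᵢⱼ ← all-allFin-violated _ ¬okᵢ
      with edge S i j | ¬okᵢⱼ | pr i j
... | nothing | ¬okₑ | _      = ⊥-elim (¬okₑ tt)
... | just s  | ¬okₑ | compat = ⊥-elim (¬okₑ (fromWitnessFalse compat))

properB⇔Proper : ∀ {n} (S : SignedGraph n) κ → properB S κ ≡ true ⇔ Proper S κ
properB⇔Proper S κ = mk⇔ (properB⇒Proper S κ ∘ Equivalence.from T-≡) (Equivalence.to T-≡ ∘ Proper⇒properB S κ)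

data PunchInView {n} (v : Fin (suc n)) : Fin (suc n) → Set where
  pivot   : PunchInView v v
  punched : ∀ i → PunchInView v (punchIn v i)

punchInView : ∀ {n} (v i : Fin (suc n)) → PunchInView v i
punchInView v i with i Fin.≟ v
... | yes refl = pivot
... | no i≢v   = subst (PunchInView v) (punchIn-punchOut (i≢v ∘ sym)) (punched _)

compatible-resp : ∀ {m m' a a' b b'} → m ≡ m' → a ≡ a' → b ≡ b' → Compatible m a b → Compatible m' a' b'
compatible-resp refl refl refl p = p

compatible-+ : ∀ {a b} → Compatible (just Sign.+) a b ⇔ a ≢ b
compatible-+ {a} {b} = mk⇔ (λ p a≡b → p (trans a≡b (sym (*-identityˡ b))))
                           (λ a≢b a≡1b → a≢b (trans a≡1b (*-identityˡ b)))

module _ {n} (S : SignedGraph (suc n)) (v : Fin (suc n)) (dom : PositiveDominating S v)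
         (κ : Vec ℤ n) (c : ℤ) where

  private
    lookup-v : lookup (insertAt κ v c) v ≡ c
    lookup-v = insertAt-lookup κ v c

    lookup-punchIn : ∀ j → lookup (insertAt κ v c) (punchIn v j) ≡ lookup κ j
    lookup-punchIn = insertAt-punchIn κ v c

    edge-from-v : ∀ j → edge S v (punchIn v j) ≡ just Sign.+
    edge-from-v j = dom (punchIn v j) (punchInᵢ≢i v j)

    edge-to-v : ∀ j → edge S (punchIn v j) v ≡ just Sign.+
    edge-to-v j = trans (symmetric S (punchIn v j) v) (edge-from-v j)

  insertAt-Proper : Proper S (insertAt κ v c) ⇔ (Avoids c κ × Proper (delete S v) κ)
  insertAt-Proper = mk⇔ (λ pr → avoids pr , restricts pr) (λ (av , pr) → extends av pr)
    where
    avoids : Proper S (insertAt κ v c) → Avoids c κ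
    avoids pr = lookup⁻ λ j →
      Equivalence.to compatible-+ (compatible-resp (edge-from-v j) lookup-v (lookup-punchIn j) (pr v (punchIn v j)))

    restricts : Proper S (insertAt κ v c) → Proper (delete S v) κ
    restricts pr i j = compatible-resp refl (lookup-punchIn i) (lookup-punchIn j) (pr (punchIn v i) (punchIn v j))

    extends : Avoids c κ → Proper (delete S v) κ → Proper S (insertAt κ v c)
    extends av pr i j with punchInView v i | punchInView v j
    ... | pivot     | pivot      = compatible-resp (sym (loopless S v)) refl refl tt
    ... | pivot     | punched j' = compatible-resp (sym (edge-from-v j')) (sym lookup-v) (sym (lookup-punchIn j'))
                                     (Equivalence.from compatible-+ (lookup⁺ av j'))
    ... | punched i' | pivot     = compatible-resp (sym (edge-to-v i')) (sym (lookup-punchIn i')) (sym lookup-v)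
                                     (Equivalence.from compatible-+ (lookup⁺ av i' ∘ sym))
    ... | punched i' | punched j' = compatible-resp refl (sym (lookup-punchIn i')) (sym (lookup-punchIn j')) (pr i' j')

proper? : ∀ {n} (S : SignedGraph n) → Decidable (λ κ → properB S κ ≡ true)
proper? S κ = properB S κ Bool.≟ true

module _ {n} (S : SignedGraph (suc n)) (v : Fin (suc n)) (dom : PositiveDominating S v) where

  properB-insertAt⇔ : ∀ κ c → properB S (insertAt κ v c) ≡ true ⇔ (Avoids c κ × properB (delete S v) κ ≡ true)
  properB-insertAt⇔ κ c = mk⇔
    (λ pr → let av , pr′ = to (insertAt-Proper S v dom κ c) (to (properB⇔Proper S _) pr)
            in av , from (properB⇔Proper (delete S v) κ) pr′)
    (λ (av , pr′) → from (properB⇔Proper S _)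
                      (from (insertAt-Proper S v dom κ c) (av , to (properB⇔Proper (delete S v) κ) pr′)))
    where open Equivalence

  count-insertAt-proper : ∀ C c →
    count (proper? S ∘ λ κ → insertAt κ v c) (allVecs C n) ≡ countProper (delete S v) (C without c)
  count-insertAt-proper C c = begin
    length (filter (proper? S ∘ λ κ → insertAt κ v c) (allVecs C n))
      ≡⟨ cong length (filter-≐ _ (avoids? c ∩? proper? (delete S v))
                       ((λ {κ} → to (properB-insertAt⇔ κ c)) , (λ {κ} → from (properB-insertAt⇔ κ c))) (allVecs C n)) ⟩
    length (filter (avoids? c ∩? proper? (delete S v)) (allVecs C n))
      ≡⟨ cong length (filter-∩ (avoids? c) (proper? (delete S v)) (allVecs C n)) ⟩
    length (filter (proper? (delete S v)) (filter (avoids? c) (allVecs C n)))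
      ≡⟨ cong (length ∘ filter (proper? (delete S v))) (filter-avoids-allVecs c C n) ⟩
    countProper (delete S v) (C without c) ∎
    where open ≡-Reasoning ; open Equivalence

  countProper-dominating : ∀ C → countProper S C ≡ sum (map (λ c → countProper (delete S v) (C without c)) C)
  countProper-dominating C =
    trans (count-allVecs-insertAt v (proper? S) C) (cong sum (map-cong (count-insertAt-proper C) C))

-- Removing a colour

module _ {xs ys : List ℤ} where

  ∈-↭ : xs ↭ ys → ∀ {z} → z ∈ xs ⇔ z ∈ ys
  ∈-↭ xs↭ys = mk⇔ (∈-resp-↭ xs↭ys) (∈-resp-↭ (↭-sym xs↭ys))

  unique-↭ : xs ↭ ys → Unique xs → Unique ys
  unique-↭ xs↭ys = PermutationSetoid.Unique-resp-↭ (setoid ℤ) (↭⇒↭ₛ xs↭ys)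

  without-↭ : ∀ c → xs ↭ ys → xs without c ↭ ys without c
  without-↭ c xs↭ys = ↭ₛ⇒↭ (PermutationSetoid.filter⁺ (setoid ℤ) (≢? c) (resp (c ≢_)) (↭⇒↭ₛ xs↭ys))

i≢0⇒i≢-i : ∀ {c} → c ≢ 0ℤ → c ≢ - c
i≢0⇒i≢-i {+ zero}    c≢0 _ = c≢0 refl
i≢0⇒i≢-i {ℤ.+[1+ _ ]} _ ()
i≢0⇒i≢-i {ℤ.-[1+ _ ]} _ ()

module _ {c : ℤ} where
  ∈-without⁻ : ∀ {z} xs → z ∈ xs without c → z ∈ xs × c ≢ z
  ∈-without⁻ xs = ∈-filter⁻ (≢? c) {xs = xs}

  ∈-without⁺ : ∀ {z} xs → z ∈ xs → c ≢ z → z ∈ xs without c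
  ∈-without⁺ xs = ∈-filter⁺ (≢? c) {xs = xs}

  unique-without : ∀ {xs} → Unique xs → Unique (xs without c)
  unique-without = AllPairs.filter⁺ (≢? c)

  without-fresh : ∀ {xs} → c ∉ xs → xs without c ≡ xs
  without-fresh {xs} c∉xs = filter-all (≢? c) (¬Any⇒All¬ xs c∉xs)

  without-++ : ∀ xs ys → (xs ++ ys) without c ≡ xs without c ++ ys without c
  without-++ = filter-++ (≢? c)

  unique∧∈⇒↭ : ∀ {xs} → Unique xs → c ∈ xs → xs ↭ c ∷ xs without c
  unique∧∈⇒↭ {x ∷ xs} (x∉xs ∷ _) (here refl) =
    prep x (↭-reflexive (sym (trans (filter-reject (≢? c) (λ c≢c → c≢c refl)) (without-fresh (All¬⇒¬Any x∉xs)))))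
  unique∧∈⇒↭ {x ∷ xs} (x∉xs ∷ u) (there c∈xs) =
    ↭-trans (prep x (unique∧∈⇒↭ u c∈xs))
            (↭-trans (swap x c ↭-refl)
                     (prep c (↭-reflexive (sym (filter-accept (≢? c) (λ c≡x → All.lookup x∉xs c∈xs (sym c≡x)))))))

module _ {c : ℤ} where

  ∈-without-pair⁻ : ∀ P {z} → z ∈ P without c without (- c) → z ∈ P × c ≢ z × - c ≢ z
  ∈-without-pair⁻ P z∈P′
    with z∈P∖c , -c≢z ← ∈-without⁻ (P without c) z∈P′
    with z∈P , c≢z ← ∈-without⁻ P z∈P∖c
    = z∈P , c≢z , -c≢z

  neg-∈-without-pair : ∀ {P} → (∀ {z} → z ∈ P → - z ∈ P) →
                       ∀ {z} → z ∈ P without c without (- c) → - z ∈ P without c without (- c)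
  neg-∈-without-pair {P} symP {z} z∈P′ with z∈P , c≢z , -c≢z ← ∈-without-pair⁻ P z∈P′ =
    ∈-without⁺ (P without c) (∈-without⁺ P (symP z∈P) (λ c≡-z → -c≢z (trans (cong -_ c≡-z) (neg-involutive z))))
               (c≢z ∘ neg-injective)

asym-neg-∷ : ∀ {c U} → c ≢ 0ℤ → c ∉ U → (∀ {z} → z ∈ U → - z ∉ U) →
             ∀ {z} → z ∈ - c ∷ U → - z ∉ - c ∷ U
asym-neg-∷ {c} c≢0 c∉U asymU (here refl) (here c′≡-c) = i≢0⇒i≢-i c≢0 (trans (sym (neg-involutive c)) c′≡-c)
asym-neg-∷ {c} c≢0 c∉U asymU (here refl) (there c′∈U) = c∉U (subst (_∈ _) (neg-involutive c) c′∈U)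
asym-neg-∷ c≢0 c∉U asymU (there z∈U) (here -z≡-c)     = c∉U (subst (_∈ _) (neg-injective -z≡-c) z∈U)
asym-neg-∷ c≢0 c∉U asymU (there z∈U) (there -z∈U)     = asymU z∈U -z∈U

zeros : Bool → List ℤ
zeros false = []
zeros true  = 0ℤ ∷ []

∉-zeros : ∀ b {c} → c ≢ 0ℤ → c ∉ zeros b
∉-zeros true c≢0 (here c≡0) = c≢0 c≡0

colourCount : Bool → ℕ → ℕ → ℕ
colourCount b mu h = mu ℕ.+ (length (zeros b) ℕ.+ 2 ℕ.* h)

-- A (λ, μ)-colour set given by its parts, where λ = colourCount b μ h: b records whether 0 is a
-- colour (that is, whether λ - μ is odd), P consists of h pairs ±c, and U of the μ unpaired colours.
record Palette (b : Bool) (mu h : ℕ) (C : List ℤ) : Set where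
  field
    P U      : List ℤ
    uniqueP  : Unique P
    uniqueU  : Unique U
    nonzeroP : ∀ {z} → z ∈ P → z ≢ 0ℤ
    nonzeroU : ∀ {z} → z ∈ U → z ≢ 0ℤ
    disjoint : ∀ {z} → z ∈ P → z ∉ U
    symP     : ∀ {z} → z ∈ P → - z ∈ P
    asymU    : ∀ {z} → z ∈ U → - z ∉ U
    sizeP    : length P ≡ 2 ℕ.* h
    sizeU    : length U ≡ mu
    layout   : C ↭ zeros b ++ P ++ U

  0∉P++U : 0ℤ ∉ P ++ U
  0∉P++U 0∈P++U = [ (λ 0∈P → nonzeroP 0∈P refl) , (λ 0∈U → nonzeroU 0∈U refl) ] (∈-++⁻ P 0∈P++U)

  unique : Unique C
  unique = unique-↭ (↭-sym layout)
    (Unique.++⁺ (uniqueZeros b) (Unique.++⁺ uniqueP uniqueU (λ (p , u) → disjoint p u))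
                (λ (z , p) → ∉-zeros b (λ { refl → 0∉P++U p }) z))
    where
    uniqueZeros : ∀ b → Unique (zeros b)
    uniqueZeros false = []
    uniqueZeros true  = [] ∷ []

  layout-without : ∀ c → C without c ↭ zeros b without c ++ P without c ++ U without c
  layout-without c = ↭-trans (without-↭ c layout)
    (↭-reflexive (trans (without-++ (zeros b) (P ++ U)) (cong (zeros b without c ++_) (without-++ P U))))

module _ {C P U : List ℤ} where
  open Equivalence

  members-even : C ↭ P ++ U → ∀ z → z ∈ C ⇔ (z ∈ P ⊎ z ∈ U)
  members-even layout z = mk⇔ (∈-++⁻ P ∘ to (∈-↭ layout)) (from (∈-↭ layout) ∘ [ ∈-++⁺ˡ , ∈-++⁺ʳ P ])

  members-odd : C ↭ 0ℤ ∷ P ++ U → ∀ z → z ∈ C ⇔ (z ∈ P ⊎ z ∈ U ⊎ z ≡ 0ℤ)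
  members-odd layout z =
    mk⇔ (classify ∘ to (∈-↭ layout)) (from (∈-↭ layout) ∘ [ there ∘ ∈-++⁺ˡ , [ there ∘ ∈-++⁺ʳ P , here ] ])
    where
    classify : z ∈ 0ℤ ∷ P ++ U → z ∈ P ⊎ z ∈ U ⊎ z ≡ 0ℤ
    classify (here z≡0)   = inj₂ (inj₂ z≡0)
    classify (there z∈PU) = Sum.map₂ inj₁ (∈-++⁻ P z∈PU)

toColourSet : ∀ {b mu h C} → Palette b mu h C → IsColourSet (colourCount b mu h) mu C
toColourSet {false} {h = h} pal = unique , record
  { Palette pal using (P; U; uniqueP; uniqueU; nonzeroP; nonzeroU; disjoint; symP; asymU; sizeU)
  ; cases = inj₁ (h , refl , sizeP , members-even layout) }
  where open Palette pal
toColourSet {true} {h = h} pal = unique , record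
  { Palette pal using (P; U; uniqueP; uniqueU; nonzeroP; nonzeroU; disjoint; symP; asymU; sizeU)
  ; cases = inj₂ (h , refl , sizeP , members-odd layout) }
  where open Palette pal

without-unpaired : ∀ {b mu h C} (pal : Palette b (suc mu) h C) {c} → c ∈ Palette.U pal →
                   Palette b mu h (C without c)
without-unpaired {b} {C = C} pal {c} c∈U = record
  { Palette pal using (P; uniqueP; nonzeroP; symP; sizeP)
  ; U        = U without c
  ; uniqueU  = unique-without uniqueU
  ; nonzeroU = nonzeroU ∘ proj₁ ∘ ∈-without⁻ U
  ; disjoint = λ z∈P → disjoint z∈P ∘ proj₁ ∘ ∈-without⁻ U
  ; asymU    = λ z∈U′ → asymU (proj₁ (∈-without⁻ U z∈U′)) ∘ proj₁ ∘ ∈-without⁻ U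
  ; sizeU    = ℕ.suc-injective (trans (sym (↭-length (unique∧∈⇒↭ uniqueU c∈U))) sizeU)
  ; layout   = subst (C without c ↭_)
                 (cong₂ (λ Z P′ → Z ++ P′ ++ U without c)
                        (without-fresh (∉-zeros b (nonzeroU c∈U))) (without-fresh (λ c∈P → disjoint c∈P c∈U)))
                 (layout-without c)
  }
  where open Palette pal

without-paired : ∀ {b mu h C} (pal : Palette b mu (suc h) C) {c} → c ∈ Palette.P pal →
                 Palette b (suc mu) h (C without c)
without-paired {b} {C = C} pal {c} c∈P = record
  { P        = P′
  ; U        = - c ∷ U
  ; uniqueP  = unique-without (unique-without uniqueP)
  ; uniqueU  = ¬Any⇒All¬ U -c∉U ∷ uniqueU
  ; nonzeroP = nonzeroP ∘ proj₁ ∘ ∈-without-pair⁻ P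
  ; nonzeroU = λ { (here refl) → c≢0 ∘ neg-injective ; (there z∈U) → nonzeroU z∈U }
  ; disjoint = λ z∈P′ → λ { (here refl) → proj₂ (proj₂ (∈-without-pair⁻ P z∈P′)) refl
                          ; (there z∈U) → disjoint (proj₁ (∈-without-pair⁻ P z∈P′)) z∈U }
  ; symP     = neg-∈-without-pair symP
  ; asymU    = asym-neg-∷ c≢0 c∉U asymU
  ; sizeP    = ℕ.suc-injective (ℕ.suc-injective (trans (sym (↭-length P↭)) (trans sizeP (ℕ.*-suc 2 _))))
  ; sizeU    = cong suc sizeU
  ; layout   = ↭-trans (subst (C without c ↭_)
                          (cong₂ (λ Z U′ → Z ++ P without c ++ U′)
                                 (without-fresh (∉-zeros b c≢0)) (without-fresh c∉U))
                          (layout-without c))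
               (++⁺ˡ (zeros b) (↭-trans (++⁺ʳ U (unique∧∈⇒↭ (unique-without uniqueP) -c∈P∖c))
                                        (↭-sym (shift (- c) P′ U))))
  }
  where
  open Palette pal
  P′ : List ℤ
  P′ = P without c without (- c)
  c≢0 : c ≢ 0ℤ
  c≢0 = nonzeroP c∈P
  c∉U : c ∉ U
  c∉U = disjoint c∈P
  -c∉U : - c ∉ U
  -c∉U = disjoint (symP c∈P)
  -c∈P∖c : - c ∈ P without c
  -c∈P∖c = ∈-without⁺ P (symP c∈P) (i≢0⇒i≢-i c≢0)
  P↭ : P ↭ c ∷ - c ∷ P′
  P↭ = ↭-trans (unique∧∈⇒↭ uniqueP c∈P) (prep c (unique∧∈⇒↭ (unique-without uniqueP) -c∈P∖c))

without-zero : ∀ {mu h C} → Palette true mu h C → Palette false mu h (C without 0ℤ)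
without-zero {C = C} pal = record
  { Palette pal using (P; U; uniqueP; uniqueU; nonzeroP; nonzeroU; disjoint; symP; asymU; sizeP; sizeU)
  ; layout = ↭-trans (without-↭ 0ℤ layout)
                     (↭-reflexive (trans (filter-reject (≢? 0ℤ) {xs = P ++ U} (λ 0≢0 → 0≢0 refl))
                                         (without-fresh 0∉P++U)))
  }
  where open Palette pal

symmetricRange : ℕ → List ℤ
symmetricRange zero    = []
symmetricRange (suc k) = ℤ.+[1+ k ] ∷ ℤ.-[1+ k ] ∷ symmetricRange k

∈-symmetricRange : ∀ {k z} → z ∈ symmetricRange k → 0 ℕ.< ∣ z ∣ × ∣ z ∣ ℕ.≤ k
∈-symmetricRange {suc k} (here refl)         = ℕ.s≤s ℕ.z≤n , ℕ.≤-refl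
∈-symmetricRange {suc k} (there (here refl)) = ℕ.s≤s ℕ.z≤n , ℕ.≤-refl
∈-symmetricRange {suc k} (there (there z∈))  = map₂ ℕ.m≤n⇒m≤1+n (∈-symmetricRange z∈)

neg-∈-symmetricRange : ∀ {k z} → z ∈ symmetricRange k → - z ∈ symmetricRange k
neg-∈-symmetricRange {suc k} (here refl)         = there (here refl)
neg-∈-symmetricRange {suc k} (there (here refl)) = here refl
neg-∈-symmetricRange {suc k} (there (there z∈))  = there (there (neg-∈-symmetricRange z∈))

unique-symmetricRange : ∀ k → Unique (symmetricRange k)
unique-symmetricRange zero    = []
unique-symmetricRange (suc k) =
  ((λ ()) ∷ ¬Any⇒All¬ _ (beyond refl)) ∷ ¬Any⇒All¬ _ (beyond refl) ∷ unique-symmetricRange k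
  where
  beyond : ∀ {z} → ∣ z ∣ ≡ suc k → z ∉ symmetricRange k
  beyond |z|≡1+k z∈ = ℕ.1+n≰n (subst (ℕ._≤ k) |z|≡1+k (proj₂ (∈-symmetricRange z∈)))

length-symmetricRange : ∀ k → length (symmetricRange k) ≡ 2 ℕ.* k
length-symmetricRange zero    = refl
length-symmetricRange (suc k) = trans (cong (suc ∘ suc) (length-symmetricRange k)) (sym (ℕ.*-suc 2 k))

largeRange : ℕ → ℕ → List ℤ
largeRange h mu = applyUpTo (λ i → ℤ.+[1+ h ℕ.+ i ]) mu

∈-largeRange : ∀ {h mu z} → z ∈ largeRange h mu → ∃[ i ] z ≡ ℤ.+[1+ h ℕ.+ i ]
∈-largeRange {h} z∈ with i , _ , z≡ ← ∈-applyUpTo⁻ (λ i → ℤ.+[1+ h ℕ.+ i ]) z∈ = i , z≡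

unique-largeRange : ∀ h mu → Unique (largeRange h mu)
unique-largeRange h mu = Unique.applyUpTo⁺₁ _ mu
  (λ i<j _ eq → ℕ.<⇒≢ i<j (ℕ.+-cancelˡ-≡ h _ _ (ℕ.suc-injective (ℤ.+-injective eq))))

canonicalPalette : ∀ b mu h → ∃[ C ] Palette b mu h C
canonicalPalette b mu h = zeros b ++ symmetricRange h ++ largeRange h mu , record
  { P        = symmetricRange h
  ; U        = largeRange h mu
  ; uniqueP  = unique-symmetricRange h
  ; uniqueU  = unique-largeRange h mu
  ; nonzeroP = λ z∈P z≡0 → ℕ.<-irrefl (sym (cong ∣_∣ z≡0)) (proj₁ (∈-symmetricRange z∈P))
  ; nonzeroU = λ z∈U → case ∈-largeRange z∈U of λ { (_ , refl) () }
  ; disjoint = λ z∈P z∈U → case ∈-largeRange z∈U of λ { (i , refl) →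
                 ℕ.1+n≰n (ℕ.≤-trans (ℕ.s≤s (ℕ.m≤m+n h i)) (proj₂ (∈-symmetricRange z∈P))) }
  ; symP     = neg-∈-symmetricRange
  ; asymU    = λ z∈U -z∈U → case ∈-largeRange z∈U of λ { (i , refl) → case ∈-largeRange -z∈U of λ { (_ , ()) } }
  ; sizeP    = length-symmetricRange h
  ; sizeU    = length-applyUpTo _ mu
  ; layout   = ↭-refl
  }

-- The recurrences

-- A record rather than a Π-type, so that S and p can be inferred from a proof.
record Counts {n} (S : SignedGraph n) (b : Bool) (p : Poly) : Set where
  field
    counts : ∀ {mu h C} → Palette b mu h C → + countProper S C ≡ eval p (+ colourCount b mu h) (+ mu)
open Counts

IsE⇒Counts : ∀ {n} {S : SignedGraph n} {p} → IsE S p → Counts S false p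
IsE⇒Counts isE .counts {mu} {h} {C} pal = isE _ mu h refl C (toColourSet pal)

IsO⇒Counts : ∀ {n} {S : SignedGraph n} {p} → IsO S p → Counts S true p
IsO⇒Counts isO .counts {mu} {h} {C} pal = isO _ mu h refl C (toColourSet pal)

recurrenceE : Poly → ℤ → ℤ → ℤ
recurrenceE E′ x y = y * eval E′ (x - 1ℤ) (y - 1ℤ) + (x - y) * eval E′ (x - 1ℤ) (y + 1ℤ)

recurrenceO : Poly → Poly → ℤ → ℤ → ℤ
recurrenceO E′ O′ x y =
  y * eval O′ (x - 1ℤ) (y - 1ℤ) + (x - y - 1ℤ) * eval O′ (x - 1ℤ) (y + 1ℤ) + eval E′ (x - 1ℤ) y

dd₂-recurrenceE : ∀ E′ → DifferenceDivisible₂ (recurrenceE E′)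
dd₂-recurrenceE E′ = dd₂-+ (dd₂-* dd₂-y (dd₂-shiftˣ -1ℤ (dd₂-shiftʸ -1ℤ (dd₂-eval E′))))
                           (dd₂-* (dd₂-- dd₂-x dd₂-y) (dd₂-shiftˣ -1ℤ (dd₂-shiftʸ 1ℤ (dd₂-eval E′))))

dd₂-recurrenceO : ∀ E′ O′ → DifferenceDivisible₂ (recurrenceO E′ O′)
dd₂-recurrenceO E′ O′ =
  dd₂-+ (dd₂-+ (dd₂-* dd₂-y (dd₂-shiftˣ -1ℤ (dd₂-shiftʸ -1ℤ (dd₂-eval O′))))
               (dd₂-* (dd₂-- (dd₂-- dd₂-x dd₂-y) (dd₂-const 1ℤ)) (dd₂-shiftˣ -1ℤ (dd₂-shiftʸ 1ℤ (dd₂-eval O′)))))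
        (dd₂-shiftˣ -1ℤ (dd₂-eval E′))

private
  even-shape : ∀ y t A B → 0ℤ + (t * B + y * A) ≡ y * A + ((y + t) - y) * B
  even-shape = solve-∀

  odd-shape : ∀ y t A B G →
    G + (t * B + y * A) ≡ y * A + ((y + (1ℤ + t)) - y - 1ℤ) * B + G
  odd-shape = solve-∀

  colourCount-paired : ∀ z mu h → mu ℕ.+ (z ℕ.+ 2 ℕ.* suc h) ≡ suc (suc mu ℕ.+ (z ℕ.+ 2 ℕ.* h))
  colourCount-paired = ℕ-Solver.solve-∀

  length≡0⇒∉ : ∀ {xs : List ℤ} {z} → length xs ≡ 0 → ¬ z ∈ xs
  length≡0⇒∉ {[]} _ ()

module _ {n} (S : SignedGraph (suc n)) (v : Fin (suc n)) (dom : PositiveDominating S v) where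

  private
    S∖v : SignedGraph n
    S∖v = delete S v

  unpaired-count : ∀ {b mu h C Q} → Counts S∖v b Q → (pal : Palette b mu h C) → ∀ {c} → c ∈ Palette.U pal →
    + countProper S∖v (C without c) ≡ eval Q (+ colourCount b mu h - 1ℤ) (+ mu - 1ℤ)
  unpaired-count {mu = zero}  hQ pal c∈U = ⊥-elim (length≡0⇒∉ (Palette.sizeU pal) c∈U)
  unpaired-count {mu = suc _} hQ pal c∈U = counts hQ (without-unpaired pal c∈U)

  paired-count : ∀ {b mu h C Q} → Counts S∖v b Q → (pal : Palette b mu h C) → ∀ {c} → c ∈ Palette.P pal →
    + countProper S∖v (C without c) ≡ eval Q (+ colourCount b mu h - 1ℤ) (+ mu + 1ℤ)
  paired-count {h = zero}  hQ pal c∈P = ⊥-elim (length≡0⇒∉ (Palette.sizeP pal) c∈P)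
  paired-count {b} {mu} {suc h} {Q = Q} hQ pal c∈P = trans (counts hQ (without-paired pal c∈P))
    (cong₂ (eval Q) (cong (λ m → + m - 1ℤ) (sym (colourCount-paired (length (zeros b)) mu h))) (cong +_ (ℕ.+-comm 1 mu)))

  zero-count : ∀ {mu h C E′} → Counts S∖v false E′ → Palette true mu h C →
    + countProper S∖v (C without 0ℤ) ≡ eval E′ (+ colourCount true mu h - 1ℤ) (+ mu)
  zero-count {mu} {h} {E′ = E′} hE′ pal = trans (counts hE′ (without-zero pal))
    (cong (λ m → eval E′ (+ m - 1ℤ) (+ mu)) (sym (ℕ.+-suc mu (2 ℕ.* h))))

  countProper-palette : ∀ {b mu h C Q} → Counts S∖v b Q → Palette b mu h C →
    let x = + colourCount b mu h ; y = + mu in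
    + countProper S C ≡ + sum (map (λ c → countProper S∖v (C without c)) (zeros b))
                        + (+ (2 ℕ.* h) * eval Q (x - 1ℤ) (y + 1ℤ) + y * eval Q (x - 1ℤ) (y - 1ℤ))
  countProper-palette {b} {mu} {h} {C} {Q} hQ pal = begin
    + countProper S C
      ≡⟨ cong +_ (trans (countProper-dominating S v dom C) (sum-↭ (map⁺ count∖ layout))) ⟩
    + sum (map count∖ (zeros b ++ P ++ U))
      ≡⟨ cong +_ (trans (sum-map-++ (zeros b) (P ++ U)) (cong (sum (map count∖ (zeros b)) ℕ.+_) (sum-map-++ P U))) ⟩
    + (sum (map count∖ (zeros b)) ℕ.+ (sum (map count∖ P) ℕ.+ sum (map count∖ U)))
      ≡⟨ trans (ℤ.pos-+ (sum (map count∖ (zeros b))) _)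
               (cong (_+_ (+ sum (map count∖ (zeros b)))) (ℤ.pos-+ (sum (map count∖ P)) _)) ⟩
    + sum (map count∖ (zeros b)) + (+ sum (map count∖ P) + + sum (map count∖ U))
      ≡⟨ cong (_+_ (+ sum (map count∖ (zeros b)))) (cong₂ _+_
           (trans (sum-map-const count∖ P (paired-count hQ pal)) (cong (λ m → + m * _) sizeP))
           (trans (sum-map-const count∖ U (unpaired-count hQ pal)) (cong (λ m → + m * _) sizeU))) ⟩
    + sum (map count∖ (zeros b)) + (+ (2 ℕ.* h) * eval Q (x - 1ℤ) (y + 1ℤ) + y * eval Q (x - 1ℤ) (y - 1ℤ)) ∎
    where
    open ≡-Reasoning
    open Palette pal
    x y : ℤ
    x = + colourCount b mu h
    y = + mu
    count∖ : ℤ → ℕ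
    count∖ c = countProper S∖v (C without c)
    sum-map-++ : ∀ xs ys → sum (map count∖ (xs ++ ys)) ≡ sum (map count∖ xs) ℕ.+ sum (map count∖ ys)
    sum-map-++ xs ys = trans (cong sum (map-++ count∖ xs ys)) (sum-++ (map count∖ xs) _)

  recurrence-even : ∀ {mu h C E′} → Counts S∖v false E′ → Palette false mu h C →
                    + countProper S C ≡ recurrenceE E′ (+ colourCount false mu h) (+ mu)
  recurrence-even {mu} {h} {E′ = E′} hE′ pal =
    trans (countProper-palette hE′ pal)
          (trans (even-shape (+ mu) (+ (2 ℕ.* h)) A B)
                 (cong (λ x → + mu * A + (x - + mu) * B) (sym (ℤ.pos-+ mu (2 ℕ.* h)))))
    where
    A B : ℤ
    A = eval E′ (+ colourCount false mu h - 1ℤ) (+ mu - 1ℤ)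
    B = eval E′ (+ colourCount false mu h - 1ℤ) (+ mu + 1ℤ)

  recurrence-odd : ∀ {mu h C E′ O′} → Counts S∖v false E′ → Counts S∖v true O′ → Palette true mu h C →
                   + countProper S C ≡ recurrenceO E′ O′ (+ colourCount true mu h) (+ mu)
  recurrence-odd {mu} {h} {C} {E′} {O′} hE′ hO′ pal =
    trans (countProper-palette hO′ pal)
          (trans (cong (_+ (+ (2 ℕ.* h) * B + + mu * A)) (trans (cong +_ (ℕ.+-identityʳ _)) (zero-count hE′ pal)))
                 (trans (odd-shape (+ mu) (+ (2 ℕ.* h)) A B G)
                        (cong (λ x → + mu * A + (x - + mu - 1ℤ) * B + G) (sym (ℤ.pos-+ mu (suc (2 ℕ.* h)))))))
    where
    A B G : ℤ
    A = eval O′ (+ colourCount true mu h - 1ℤ) (+ mu - 1ℤ)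
    B = eval O′ (+ colourCount true mu h - 1ℤ) (+ mu + 1ℤ)
    G = eval E′ (+ colourCount true mu h - 1ℤ) (+ mu)

agree-on-palettes : ∀ b {F G} → DifferenceDivisible₂ F → DifferenceDivisible₂ G →
  (∀ mu h → F (+ colourCount b mu h) (+ mu) ≡ G (+ colourCount b mu h) (+ mu)) → ∀ x y → F x y ≡ G x y
agree-on-palettes b dF dG agree = dd₂-agree dF dG λ mu N →
  colourCount b mu N ,
  ℕ.≤-trans (ℕ.m≤m+n N _) (ℕ.≤-trans (ℕ.m≤n+m _ (length (zeros b))) (ℕ.m≤n+m _ mu)) ,
  agree mu N

proposition4p9 : ∀ {n : ℕ} (S : SignedGraph (suc n)) (v : Fin (suc n)) →
    PositiveDominating S v →
    (E O E' O' : Poly) →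
    IsE S E → IsO S O → IsE (delete S v) E' → IsO (delete S v) O' →
    (∀ x y → eval E x y ≡ y * eval E' (x - 1ℤ) (y - 1ℤ) + (x - y) * eval E' (x - 1ℤ) (y + 1ℤ))
    ×
    (∀ x y → eval O x y ≡ y * eval O' (x - 1ℤ) (y - 1ℤ) + (x - y - 1ℤ) * eval O' (x - 1ℤ) (y + 1ℤ) + eval E' (x - 1ℤ) y)
proposition4p9 S v dom E O E' O' isE isO isE' isO' =
  agree-on-palettes false (dd₂-eval E) (dd₂-recurrenceE E') even ,
  agree-on-palettes true (dd₂-eval O) (dd₂-recurrenceO E' O') odd
  where
  hE : Counts S false E
  hE = IsE⇒Counts isE
  hO : Counts S true O
  hO = IsO⇒Counts isO
  hE′ : Counts (delete S v) false E'
  hE′ = IsE⇒Counts isE'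
  hO′ : Counts (delete S v) true O'
  hO′ = IsO⇒Counts isO'
  even : ∀ mu h → eval E (+ colourCount false mu h) (+ mu) ≡ recurrenceE E' (+ colourCount false mu h) (+ mu)
  even mu h with C , pal ← canonicalPalette false mu h =
    trans (sym (counts hE pal)) (recurrence-even S v dom hE′ pal)
  odd : ∀ mu h → eval O (+ colourCount true mu h) (+ mu) ≡ recurrenceO E' O' (+ colourCount true mu h) (+ mu)
  odd mu h with C , pal ← canonicalPalette true mu h =
    trans (sym (counts hO pal)) (recurrence-odd S v dom hE′ hO′ pal)
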